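{- Let $G$ be a simple graph with at least one vertex and without isolated vertices, with $m$ edges, maximum degree $\Delta$, and arranged degree sequence $d_1\ge\cdots\ge d_n$. Let $k^*=\min\{k\in\mathbb{N},\ 2k\le n : \sum_{i=1}^{2k}d_i-m-k\ge 0\}$. Then $$\frac12\cdot\frac{m}{\Delta+1}<\frac{m}{2\Delta-1}\le k^*.$$ -}

module Defs where

open import Data.Nat using (ℕ; zero; suc; _+_; _*_; _∸_; _<ᵇ_; _⊔_)
open import Data.Nat.Properties using (≤-decTotalOrder)
open import Data.Bool using (Bool; true; false; if_then_else_; _∧_)
open import Data.Fin using (Fin; toℕ)
open import Data.List using (List; map; reverse; allFin; take; foldr)
open import Data.Nat.ListAction using (sum)
open import Data.Product using (∃)
open import Data.Integer using (+_)
open import Data.Rational using (ℚ; 0ℚ; _/_)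
open import Relation.Binary.PropositionalEquality using (_≡_)
open import Data.List.Sort ≤-decTotalOrder using (sort)

record SimpleGraph (n : ℕ) : Set where
  field
    Adj    : Fin n → Fin n → Bool
    sym    : ∀ i j → Adj i j ≡ Adj j i
    irrefl : ∀ i → Adj i i ≡ false
open SimpleGraph public

b2n : Bool → ℕ
b2n true  = 1
b2n false = 0

module _ {n : ℕ} (G : SimpleGraph n) where
  degree : Fin n → ℕ
  degree i = sum (map (λ j → b2n (Adj G i j)) (allFin n))

  edgeCount : ℕ
  edgeCount = sum (map (λ i → sum (map (λ j → b2n ((toℕ i <ᵇ toℕ j) ∧ Adj G i j)) (allFin n))) (allFin n))

  maxDegree : ℕ
  maxDegree = foldr _⊔_ 0 (map degree (allFin n))

  degSeq : List ℕ
  degSeq = reverse (sort (map degree (allFin n)))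

  topSum : ℕ → ℕ
  topSum r = sum (take r degSeq)

  -- "∑_{i=1}^{2k} dᵢ − m − k ≥ 0"  (stated in ℕ without truncated subtraction)
  KCond : ℕ → Set
  KCond k = edgeCount + k Data.Nat.≤ topSum (2 * k)

  NoIsolated : Set
  NoIsolated = ∀ i → ∃ λ j → Adj G i j ≡ true

-- the rational a / b  (only used with b > 0; b = 0 gives 0 by convention)
frac : ℕ → ℕ → ℚ
frac a zero    = 0ℚ
frac a (suc b) = (+ a) / suc b

-- By the handshake lemma d₁ + ⋯ + dₙ = 2m. If n = 2k, the prefix of length 2k is the whole
-- sequence and m ≥ k because every degree is positive. If n = 2k + 1, each of the 2k largest
-- degrees is at least dₙ, so T = 2m − dₙ ≥ 2k·dₙ, which forces m + k ≤ T (for dₙ = 1 because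
-- T is then odd, hence T ≠ 2k). So k* exists, and m + k* ≤ d₁ + ⋯ + d_{2k*} ≤ 2k*Δ gives
-- m ≤ (2Δ − 1)k*; the remaining inequality is 2Δ − 1 < 2(Δ + 1).
module Submission where

open import Defs hiding (sym)
open import Data.Nat
  using (ℕ; zero; suc; pred; _+_; _*_; _∸_; _≤_; _≥_; _<_; _≤?_; _<ᵇ_; _⊔_; z≤n; s≤s; z<s)
open import Data.Nat.Properties
open import Data.Nat.Induction using (<-rec)
open import Data.Nat.ListAction using (sum)
open import Data.Nat.ListAction.Properties using (sum-↭)
open import Data.Nat.Tactic.RingSolver using (solve-∀)
open import Data.Bool using (true; false; _∧_)
open import Data.Fin using (Fin; toℕ; zero; suc; fromℕ<)
open import Data.Fin.Properties using (toℕ-injective)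
open import Data.List
  using (List; []; _∷_; [_]; _++_; length; map; reverse; take; foldr; allFin; tabulate)
open import Data.List.Properties
  using (length-map; length-tabulate; length-reverse; unfold-reverse; take-all; map-cong)
open import Data.List.Relation.Unary.All using (All; []; _∷_)
open import Data.List.Relation.Unary.All.Properties using (map⁺; tabulate⁺)
open import Data.List.Relation.Unary.AllPairs using (_∷_)
open import Data.List.Relation.Unary.Any using (here; there)
open import Data.List.Membership.Propositional using (_∈_)
open import Data.List.Membership.Propositional.Properties using (∈-map⁺; ∈-allFin)
open import Data.List.Relation.Binary.Permutation.Propositional using (_↭_; ↭-sym; ↭-trans)
open import Data.List.Relation.Binary.Permutation.Propositional.Properties
  using (All-resp-↭; ↭-reverse; ↭-length)
open import Data.List.Relation.Unary.Sorted.TotalOrder ≤-totalOrder using (Sorted)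
open import Data.List.Relation.Unary.Sorted.TotalOrder.Properties using (Sorted⇒AllPairs)
open import Data.List.Sort ≤-decTotalOrder using (sort; sort-↭; sort-↗)
open import Data.Product using (Σ; ∃-syntax; _×_; _,_; proj₂)
open import Data.Sum using (_⊎_; inj₁; inj₂)
open import Function using (_∘_)
open import Relation.Unary using (Pred; Decidable)
open import Relation.Nullary using (yes; no; ofʸ; ofⁿ; contradiction)
open import Relation.Nullary.Decidable using (_×-dec_)
open import Relation.Binary.PropositionalEquality hiding ([_])
open import Algebra.Properties.CommutativeMonoid.Sum +-0-commutativeMonoid
  using (sum-syntax; ∑-distrib-+; ∑-comm; sum-cong-≗) renaming (sum to ∑)
import Data.Integer as ℤ
import Data.Integer.Properties as ℤ
open import Data.Rational using (½; toℚᵘ) renaming (_*_ to _*ℚ_; _≤_ to _≤ℚ_; _<_ to _<ℚ_)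
import Data.Rational.Properties as ℚ
open import Data.Rational.Unnormalised as ℚᵘ using (mkℚᵘ; *≤*; *<*; *≡*)
import Data.Rational.Unnormalised.Properties as ℚᵘ

private variable
  a b c k m t x y : ℕ
  xs : List ℕ

∈⇒≤sum : x ∈ xs → x ≤ sum xs
∈⇒≤sum (here refl)                 = m≤m+n _ _
∈⇒≤sum {xs = y ∷ _} (there x∈xs) = ≤-trans (∈⇒≤sum x∈xs) (m≤n+m _ y)

∈⇒≤foldr-⊔ : x ∈ xs → x ≤ foldr _⊔_ 0 xs
∈⇒≤foldr-⊔ (here refl)                 = m≤m⊔n _ _
∈⇒≤foldr-⊔ {xs = y ∷ _} (there x∈xs) = ≤-trans (∈⇒≤foldr-⊔ x∈xs) (m≤n⊔m y _)

length*≤sum : All (c ≤_) xs → length xs * c ≤ sum xs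
length*≤sum []         = z≤n
length*≤sum (c≤x ∷ cs) = +-mono-≤ c≤x (length*≤sum cs)

sum-take≤* : All (_≤ c) xs → ∀ r → sum (take r xs) ≤ r * c
sum-take≤* []         zero    = z≤n
sum-take≤* []         (suc r) = z≤n
sum-take≤* (_ ∷ _)    zero    = z≤n
sum-take≤* (x≤c ∷ cs) (suc r) = +-mono-≤ x≤c (sum-take≤* cs r)

sum-reverse : ∀ xs → sum (reverse xs) ≡ sum xs
sum-reverse xs = sum-↭ (↭-reverse xs)

take-length-++ : ∀ {A : Set} (xs ys : List A) → take (length xs) (xs ++ ys) ≡ xs
take-length-++ []       ys = refl
take-length-++ (x ∷ xs) ys = cong (x ∷_) (take-length-++ xs ys)

sum-map-tabulate : ∀ {A : Set} {n} (f : A → ℕ) (g : Fin n → A) →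
                   sum (map f (tabulate g)) ≡ ∑ (f ∘ g)
sum-map-tabulate {n = zero}  f g = refl
sum-map-tabulate {n = suc n} f g = cong (f (g zero) +_) (sum-map-tabulate f (g ∘ suc))

sum-allFin : ∀ {n} (f : Fin n → ℕ) → sum (map f (allFin n)) ≡ ∑ f
sum-allFin f = sum-map-tabulate f (λ i → i)

even⊎odd : ∀ n → ∃[ k ] (n ≡ 2 * k ⊎ n ≡ suc (2 * k))
even⊎odd zero = 0 , inj₁ refl
even⊎odd (suc n) with even⊎odd n
... | k , inj₁ n≡2k   = k , inj₂ (cong suc n≡2k)
... | k , inj₂ n≡2k+1 = suc k , inj₁ (trans (cong suc n≡2k+1) (cong suc (sym (+-suc k (k + 0)))))

m+n≤m*n : 2 ≤ a → 2 ≤ b → a + b ≤ a * b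
m+n≤m*n {suc (suc a)} {suc (suc b)} (s≤s (s≤s _)) (s≤s (s≤s _)) =
  subst (suc (suc a) + suc (suc b) ≤_) (expand a b) (m≤m+n _ (a * b + a + b))
  where
  expand : ∀ a b → (2 + a) + (2 + b) + (a * b + a + b) ≡ (2 + a) * (2 + b)
  expand = solve-∀

least-witness : ∀ {p} {P : Pred ℕ p} → Decidable P → ∀ {n} → P n →
                ∃[ k ] P k × (∀ {j} → P j → k ≤ j)
least-witness {P = P} P? = <-rec (λ n → P n → ∃[ k ] P k × (∀ {j} → P j → k ≤ j)) search _
  where
  search : ∀ n → (∀ {j} → j < n → P j → ∃[ k ] P k × (∀ {i} → P i → k ≤ i)) →
           P n → ∃[ k ] P k × (∀ {i} → P i → k ≤ i)
  search n below Pn with anyUpTo? P? n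
  ... | yes (j , j<n , Pj) = below j<n Pj
  ... | no  none           = n , Pn , λ {j} Pj → ≮⇒≥ (λ j<n → none (j , j<n , Pj))

odd-gap : 1 ≤ y → 1 ≤ k → 2 * k * y ≤ t → y + t ≡ 2 * m → y + 2 * k ≤ t
odd-gap {suc zero} {k} {t} {m} _ _ 2k*1≤t 1+t≡2m =
  ≤∧≢⇒< (subst (_≤ t) (*-identityʳ (2 * k)) 2k*1≤t)
        (λ 2k≡t → even≢odd m k (sym (trans (cong suc 2k≡t) 1+t≡2m)))
odd-gap {suc (suc y)} {k} 2≤y 1≤k 2ky≤t _ =
  ≤-trans (≤-reflexive (+-comm (suc (suc y)) (2 * k)))
          (≤-trans (m+n≤m*n (*-monoʳ-≤ 2 1≤k) (s≤s (s≤s z≤n))) 2ky≤t)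

odd-prefix-bound : 1 ≤ y → 1 ≤ k → 2 * k * y ≤ t → y + t ≡ 2 * m → m + k ≤ t
odd-prefix-bound {y} {k} {t} {m} 1≤y 1≤k 2ky≤t y+t≡2m = *-cancelˡ-≤ 2 (begin
  2 * (m + k)       ≡⟨ *-distribˡ-+ 2 m k ⟩
  2 * m + 2 * k     ≡⟨ cong (_+ 2 * k) y+t≡2m ⟨
  y + t + 2 * k     ≡⟨ +-assoc y t (2 * k) ⟩
  y + (t + 2 * k)   ≡⟨ cong (y +_) (+-comm t (2 * k)) ⟩
  y + (2 * k + t)   ≡⟨ +-assoc y (2 * k) t ⟨
  y + 2 * k + t     ≤⟨ +-monoˡ-≤ t (odd-gap {m = m} 1≤y 1≤k 2ky≤t y+t≡2m) ⟩
  t + t             ≡⟨ cong (t +_) (+-identityʳ t) ⟨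
  2 * t             ∎)
  where open ≤-Reasoning

even-prefix-bound : length xs ≡ 2 * k → All (1 ≤_) xs → sum xs ≡ 2 * m → m + k ≤ sum xs
even-prefix-bound {xs} {k} {m} len≡2k pos sum≡2m = begin
  m + k   ≤⟨ +-monoʳ-≤ m k≤m ⟩
  m + m   ≡⟨ cong (m +_) (+-identityʳ m) ⟨
  2 * m   ≡⟨ sum≡2m ⟨
  sum xs  ∎
  where
  open ≤-Reasoning
  k≤m : k ≤ m
  k≤m = *-cancelˡ-≤ 2 (subst₂ _≤_ (trans (*-identityʳ _) len≡2k) sum≡2m (length*≤sum pos))

heavy-prefix : Sorted xs → All (1 ≤_) xs → 2 ≤ length xs → sum xs ≡ 2 * m →
               ∃[ k ] 2 * k ≤ length xs × m + k ≤ sum (take (2 * k) (reverse xs))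
heavy-prefix {xs} {m} _ pos _ sum≡2m with even⊎odd (length xs)
... | k , inj₁ len≡2k =
  k , ≤-reflexive (sym len≡2k) ,
  subst (m + k ≤_) (sym top≡all) (even-prefix-bound {k = k} {m = m} len≡2k pos sum≡2m)
  where
  top≡all : sum (take (2 * k) (reverse xs)) ≡ sum xs
  top≡all = trans (cong sum (take-all (2 * k) (reverse xs) 2k≥len)) (sum-reverse xs)
    where
    2k≥len : 2 * k ≥ length (reverse xs)
    2k≥len = ≤-reflexive (trans (length-reverse xs) len≡2k)
heavy-prefix {y ∷ zs} {m} sorted (1≤y ∷ _) _ sum≡2m | suc k , inj₂ len≡2k+1 =
  suc k , m≤n⇒m≤1+n (≤-reflexive (sym len-zs)) ,
  subst (m + suc k ≤_) (sym top≡rest)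
    (odd-prefix-bound {m = m} 1≤y (s≤s z≤n) 2k*y≤sum-zs sum≡2m)
  where
  len-zs : length zs ≡ 2 * suc k
  len-zs = suc-injective len≡2k+1
  y≤zs : All (y ≤_) zs
  y≤zs with Sorted⇒AllPairs ≤-totalOrder sorted
  ... | y≤zs ∷ _ = y≤zs
  2k*y≤sum-zs : 2 * suc k * y ≤ sum zs
  2k*y≤sum-zs = subst (λ l → l * y ≤ sum zs) len-zs (length*≤sum y≤zs)
  top≡rest : sum (take (2 * suc k) (reverse (y ∷ zs))) ≡ sum zs
  top≡rest = begin
    sum (take (2 * suc k) (reverse (y ∷ zs)))
      ≡⟨ cong₂ (λ r l → sum (take r l)) (trans (sym len-zs) (sym (length-reverse zs)))
               (unfold-reverse y zs) ⟩
    sum (take (length (reverse zs)) (reverse zs ++ [ y ]))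
      ≡⟨ cong sum (take-length-++ (reverse zs) [ y ]) ⟩
    sum (reverse zs)
      ≡⟨ sum-reverse zs ⟩
    sum zs ∎
    where open ≡-Reasoning
heavy-prefix {_ ∷ []}    _ _ (s≤s ()) _ | zero , inj₂ _
heavy-prefix {_ ∷ _ ∷ _} _ _ _        _ | zero , inj₂ ()

toℚᵘ-frac : ∀ a b → toℚᵘ (frac a (suc b)) ℚᵘ.≃ mkℚᵘ (ℤ.+ a) b
toℚᵘ-frac a b = ℚ.toℚᵘ-fromℚᵘ (mkℚᵘ (ℤ.+ a) b)

frac-mono-≤ : ∀ a b c d → a * suc d ≤ c * suc b → frac a (suc b) ≤ℚ frac c (suc d)
frac-mono-≤ a b c d ad≤cb = ℚ.toℚᵘ-cancel-≤
  (ℚᵘ.≤-respˡ-≃ (ℚᵘ.≃-sym (toℚᵘ-frac a b)) (ℚᵘ.≤-respʳ-≃ (ℚᵘ.≃-sym (toℚᵘ-frac c d))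
    (*≤* (subst₂ ℤ._≤_ (ℤ.pos-* a (suc d)) (ℤ.pos-* c (suc b)) (ℤ.+≤+ ad≤cb)))))

frac-mono-< : ∀ a b c d → a * suc d < c * suc b → frac a (suc b) <ℚ frac c (suc d)
frac-mono-< a b c d ad<cb = ℚ.toℚᵘ-cancel-<
  (ℚᵘ.<-respˡ-≃ (ℚᵘ.≃-sym (toℚᵘ-frac a b)) (ℚᵘ.<-respʳ-≃ (ℚᵘ.≃-sym (toℚᵘ-frac c d))
    (*<* (subst₂ ℤ._<_ (ℤ.pos-* a (suc d)) (ℤ.pos-* c (suc b)) (ℤ.+<+ ad<cb)))))

½*frac : ∀ a b → ½ *ℚ frac a (suc b) ≡ frac a (2 * suc b)
½*frac a b = ℚ.toℚᵘ-injective (begin-equality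
  toℚᵘ (½ *ℚ frac a (suc b))          ≃⟨ ℚ.toℚᵘ-homo-* ½ (frac a (suc b)) ⟩
  toℚᵘ ½ ℚᵘ.* toℚᵘ (frac a (suc b))
    ≃⟨ ℚᵘ.*-cong (ℚ.toℚᵘ-fromℚᵘ (mkℚᵘ (ℤ.+ 1) 1)) (toℚᵘ-frac a b) ⟩
  mkℚᵘ (ℤ.+ 1) 1 ℚᵘ.* mkℚᵘ (ℤ.+ a) b
    ≃⟨ *≡* (cong (ℤ._* ℤ.+ (2 * suc b)) (ℤ.*-identityˡ (ℤ.+ a))) ⟩
  mkℚᵘ (ℤ.+ a) (pred (2 * suc b))     ≃⟨ toℚᵘ-frac a (pred (2 * suc b)) ⟨
  toℚᵘ (frac a (2 * suc b))           ∎)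
  where open ℚᵘ.≤-Reasoning

2*[1+n]∸1≡1+2*n : ∀ n → 2 * suc n ∸ 1 ≡ suc (2 * n)
2*[1+n]∸1≡1+2*n n = +-suc n (n + 0)

½*m/[Δ+1]<m/[2Δ∸1] : ∀ {m Δ} → 0 < m → 0 < Δ → ½ *ℚ frac m (Δ + 1) <ℚ frac m (2 * Δ ∸ 1)
½*m/[Δ+1]<m/[2Δ∸1] {m@(suc _)} {suc d} _ _
  rewrite ½*frac m (d + 1) | 2*[1+n]∸1≡1+2*n d =
  frac-mono-< m (pred (2 * suc (d + 1))) m (2 * d) (*-monoʳ-< m 1+2d<2[d+2])
  where
  2[d+2]≡1+2d+3 : ∀ d → 2 * suc (d + 1) ≡ suc (2 * d) + 3
  2[d+2]≡1+2d+3 = solve-∀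
  1+2d<2[d+2] : suc (2 * d) < 2 * suc (d + 1)
  1+2d<2[d+2] = subst (suc (2 * d) <_) (sym (2[d+2]≡1+2d+3 d)) (m<m+n _ z<s)

m+k≤2kΔ⇒m/[2Δ∸1]≤k : ∀ {m k Δ} → m + k ≤ 2 * k * Δ → 0 < Δ → frac m (2 * Δ ∸ 1) ≤ℚ frac k 1
m+k≤2kΔ⇒m/[2Δ∸1]≤k {m} {k} {suc d} m+k≤2k[1+d] _ rewrite 2*[1+n]∸1≡1+2*n d =
  frac-mono-≤ m (2 * d) k 0 (subst (_≤ k * suc (2 * d)) (sym (*-identityʳ m))
    (+-cancelʳ-≤ k m (k * suc (2 * d))
      (subst (m + k ≤_) (2k[1+d]≡k[1+2d]+k k d) m+k≤2k[1+d])))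
  where
  2k[1+d]≡k[1+2d]+k : ∀ k d → 2 * k * suc d ≡ k * suc (2 * d) + k
  2k[1+d]≡k[1+2d]+k = solve-∀

module _ {n : ℕ} (G : SimpleGraph n) where

  degrees : List ℕ
  degrees = map (degree G) (allFin n)

  All-degrees : ∀ {p} {P : Pred ℕ p} → (∀ i → P (degree G i)) → All P degrees
  All-degrees P-degree = map⁺ (tabulate⁺ P-degree)

  forwardEdge : Fin n → Fin n → ℕ
  forwardEdge i j = b2n ((toℕ i <ᵇ toℕ j) ∧ Adj G i j)

  adjacency-split : ∀ i j → b2n (Adj G i j) ≡ forwardEdge i j + forwardEdge j i
  adjacency-split i j
    with toℕ i <ᵇ toℕ j | <ᵇ-reflects-< (toℕ i) (toℕ j)
       | toℕ j <ᵇ toℕ i | <ᵇ-reflects-< (toℕ j) (toℕ i)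
  ... | true  | ofʸ i<j | true  | ofʸ j<i = contradiction j<i (<⇒≯ i<j)
  ... | true  | _       | false | _       = sym (+-identityʳ _)
  ... | false | _       | true  | _       = cong b2n (SimpleGraph.sym G i j)
  ... | false | ofⁿ i≮j | false | ofⁿ j≮i
    rewrite toℕ-injective (≤-antisym (≮⇒≥ j≮i) (≮⇒≥ i≮j)) = cong b2n (irrefl G j)

  edgeCount≡∑ : edgeCount G ≡ ∑[ i < n ] ∑[ j < n ] forwardEdge i j
  edgeCount≡∑ = trans (cong sum (map-cong (λ i → sum-allFin (forwardEdge i)) (allFin n)))
                      (sum-allFin (λ i → ∑ (forwardEdge i)))

  handshake : sum degrees ≡ 2 * edgeCount G
  handshake = begin
    sum degrees
      ≡⟨ sum-allFin (degree G) ⟩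
    ∑[ i < n ] degree G i
      ≡⟨ sum-cong-≗ (λ i → trans (sum-allFin (λ j → b2n (Adj G i j)))
                                 (sum-cong-≗ (adjacency-split i))) ⟩
    ∑[ i < n ] ∑[ j < n ] (forwardEdge i j + forwardEdge j i)
      ≡⟨ sum-cong-≗ (λ i → ∑-distrib-+ (forwardEdge i) (λ j → forwardEdge j i)) ⟩
    ∑[ i < n ] (∑[ j < n ] forwardEdge i j + ∑[ j < n ] forwardEdge j i)
      ≡⟨ ∑-distrib-+ (λ i → ∑ (forwardEdge i)) (λ i → ∑[ j < n ] forwardEdge j i) ⟩
    ∑[ i < n ] ∑[ j < n ] forwardEdge i j + ∑[ i < n ] ∑[ j < n ] forwardEdge j i
      ≡⟨ cong (∑[ i < n ] ∑[ j < n ] forwardEdge i j +_) (∑-comm (λ i j → forwardEdge j i)) ⟩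
    ∑[ i < n ] ∑[ j < n ] forwardEdge i j + ∑[ j < n ] ∑[ i < n ] forwardEdge j i
      ≡⟨ cong₂ _+_ edgeCount≡∑ edgeCount≡∑ ⟨
    edgeCount G + edgeCount G
      ≡⟨ cong (edgeCount G +_) (+-identityʳ _) ⟨
    2 * edgeCount G ∎
    where open ≡-Reasoning

  NoIsolated⇒0<degree : NoIsolated G → ∀ i → 0 < degree G i
  NoIsolated⇒0<degree noIso i with noIso i
  ... | j , adj = subst (λ e → b2n e ≤ degree G i) adj (∈⇒≤sum (∈-map⁺ _ (∈-allFin j)))

  degree≤maxDegree : ∀ i → degree G i ≤ maxDegree G
  degree≤maxDegree i = ∈⇒≤foldr-⊔ (∈-map⁺ (degree G) (∈-allFin i))

  0<maxDegree : 0 < n → NoIsolated G → 0 < maxDegree G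
  0<maxDegree 0<n noIso = ≤-trans (NoIsolated⇒0<degree noIso v) (degree≤maxDegree v)
    where
    v : Fin n
    v = fromℕ< 0<n

  0<edgeCount : 0 < n → NoIsolated G → 0 < edgeCount G
  0<edgeCount 0<n noIso = *-cancelˡ-< 2 0 (edgeCount G) (begin-strict
    0                 <⟨ NoIsolated⇒0<degree noIso v ⟩
    degree G v        ≤⟨ ∈⇒≤sum (∈-map⁺ (degree G) (∈-allFin v)) ⟩
    sum degrees       ≡⟨ handshake ⟩
    2 * edgeCount G   ∎)
    where
    open ≤-Reasoning
    v : Fin n
    v = fromℕ< 0<n

  degSeq↭degrees : degSeq G ↭ degrees
  degSeq↭degrees = ↭-trans (↭-reverse (sort degrees)) (sort-↭ degrees)

  topSum≤*maxDegree : ∀ r → topSum G r ≤ r * maxDegree G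
  topSum≤*maxDegree =
    sum-take≤* (All-resp-↭ (↭-sym degSeq↭degrees) (All-degrees degree≤maxDegree))

  KCond⇒edgeCount+k≤2k*maxDegree : KCond G k → edgeCount G + k ≤ 2 * k * maxDegree G
  KCond⇒edgeCount+k≤2k*maxDegree {k} kcond = ≤-trans kcond (topSum≤*maxDegree (2 * k))

  KCond-witness : 2 ≤ n → NoIsolated G → ∃[ k ] 2 * k ≤ n × KCond G k
  KCond-witness 2≤n noIso =
    subst (λ l → ∃[ k ] 2 * k ≤ l × KCond G k) length-sorted
      (heavy-prefix (sort-↗ degrees) positive (subst (2 ≤_) (sym length-sorted) 2≤n)
                    (trans (sum-↭ (sort-↭ degrees)) handshake))
    where
    length-sorted : length (sort degrees) ≡ n
    length-sorted = trans (↭-length (sort-↭ degrees))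
                          (trans (length-map (degree G) (allFin n)) (length-tabulate (λ i → i)))
    positive : All (1 ≤_) (sort degrees)
    positive = All-resp-↭ (↭-sym (sort-↭ degrees)) (All-degrees (NoIsolated⇒0<degree noIso))

NoIsolated⇒2≤n : ∀ {n} (G : SimpleGraph n) → 1 ≤ n → NoIsolated G → 2 ≤ n
NoIsolated⇒2≤n {suc zero} G _ noIso with noIso zero
... | zero , adj = contradiction (trans (sym adj) (irrefl G zero)) λ ()
NoIsolated⇒2≤n {suc (suc n)} _ _ _ = s≤s (s≤s z≤n)

lemma4p9 : (n : ℕ) → (G : SimpleGraph n) → 1 ≤ n → NoIsolated G →
    Σ ℕ (λ kstar →
      (2 * kstar ≤ n) × KCond G kstar ×
      ((k : ℕ) → 2 * k ≤ n → KCond G k → kstar ≤ k) ×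
      ((½ *ℚ frac (edgeCount G) (maxDegree G + 1)) <ℚ frac (edgeCount G) (2 * maxDegree G ∸ 1)) ×
      (frac (edgeCount G) (2 * maxDegree G ∸ 1) ≤ℚ frac kstar 1))
lemma4p9 n G 1≤n noIso
  with least-witness (λ k → (2 * k ≤? n) ×-dec (edgeCount G + k ≤? topSum G (2 * k)))
                     (proj₂ (KCond-witness G (NoIsolated⇒2≤n G 1≤n noIso) noIso))
... | kstar , (2kstar≤n , kcond) , minimal =
  kstar , 2kstar≤n , kcond , (λ k 2k≤n kcond′ → minimal (2k≤n , kcond′)) ,
  ½*m/[Δ+1]<m/[2Δ∸1] 0<m 0<Δ ,
  m+k≤2kΔ⇒m/[2Δ∸1]≤k (KCond⇒edgeCount+k≤2k*maxDegree G kcond) 0<Δ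
  where
  0<m : 0 < edgeCount G
  0<m = 0<edgeCount G 1≤n noIso
  0<Δ : 0 < maxDegree G
  0<Δ = 0<maxDegree G 1≤n noIso
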